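{- For every oriented graph $D$ there is a tournament $D^*$ on the same vertex set with $D\subseteq D^*$ (every edge of $D$ is an edge of $D^*$ with the same orientation) and $\mathrm{inv}(D^*)=\mathrm{inv}(D)$.
   Context: An oriented graph is a simple directed graph with no loops and at most one of the edges $uv$, $vu$ for each pair of distinct vertices; a tournament is an oriented graph with exactly one of $uv$, $vu$ for every pair of distinct vertices. For $X\subseteq V(D)$, inverting $X$ means reversing the orientation of every edge with both endpoints in $X$. The inversion number $\mathrm{inv}(D)$ is the minimum number of sets whose successive inversion yields an acyclic oriented graph. -}

module Defs where

open import Data.Nat using (ℕ; _<_)
open import Data.Fin using (Fin)
open import Data.Bool using (Bool; true; false; _∧_; if_then_else_)
open import Data.List using (List; []; _∷_; length)
open import Data.Product using (Σ; _×_; ∃-syntax)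
open import Data.Sum using (_⊎_)
open import Relation.Nullary using (¬_)
open import Relation.Binary.PropositionalEquality using (_≡_; _≢_)
open import Relation.Binary.Construct.Closure.Transitive using (TransClosure)

Digraph : ℕ → Set
Digraph n = Fin n → Fin n → Bool

Edge : ∀ {n} → Digraph n → Fin n → Fin n → Set
Edge D u v = D u v ≡ true

Oriented : ∀ {n} → Digraph n → Set
Oriented {n} D = (∀ v → ¬ Edge D v v) × (∀ u v → Edge D u v → ¬ Edge D v u)

Tournament : ∀ {n} → Digraph n → Set
Tournament {n} D = Oriented D × (∀ u v → u ≢ v → Edge D u v ⊎ Edge D v u)

_⊆D_ : ∀ {n} → Digraph n → Digraph n → Set
_⊆D_ {n} D D' = ∀ u v → Edge D u v → Edge D' u v

VSet : ℕ → Set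
VSet n = Fin n → Bool

invert : ∀ {n} → VSet n → Digraph n → Digraph n
invert X D u v = if X u ∧ X v then D v u else D u v

invertAll : ∀ {n} → List (VSet n) → Digraph n → Digraph n
invertAll []       D = D
invertAll (X ∷ Xs) D = invertAll Xs (invert X D)

Acyclic : ∀ {n} → Digraph n → Set
Acyclic {n} D = ∀ v → ¬ TransClosure (Edge D) v v

InvertibleWith : ∀ {n} → Digraph n → ℕ → Set
InvertibleWith {n} D k = ∃[ Xs ] (length {A = VSet n} Xs ≡ k × Acyclic (invertAll Xs D))

IsInv : ∀ {n} → Digraph n → ℕ → Set
IsInv D k = InvertibleWith D k × (∀ j → j < k → ¬ InvertibleWith D j)

-- Take an optimal family X₁, …, Xₖ for D, so that D′ = D inverted by it is acyclic.  Extend D′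
-- to a transitive tournament T by a topological order, and let D* be T inverted by Xₖ, …, X₁.
-- Inversion is an involution, so D ⊆ D* and inverting X₁, …, Xₖ turns D* back into T, whence
-- inv(D*) ≤ k; conversely every family making D* acyclic makes its subgraph D acyclic.
-- An optimal family exists because acyclicity is decidable and some family always works:
-- inverting the pair {u, v} reverses just the edge uv, so every backward edge can be turned.
module Submission where

open import Level using (Level)
open import Data.Nat using (ℕ; zero; suc; _<_; _≤_; s≤s; _<?_)
open import Data.Nat.Properties
  using ( ≮⇒≥; ≤∧≢⇒<; ≤-pred; suc-injective; ≤-refl; ≤-reflexive; m<1+n⇒m<n∨m≡n; <-≤-trans; m<n⇒m<1+n
        ; <-cmp; <-strictPartialOrder; <-strictTotalOrder)
  renaming (_≟_ to _≟ℕ_)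
open import Data.Fin using (Fin; toℕ; fromℕ<; _≟_)
open import Data.Fin.Properties using (toℕ-injective; toℕ<n; toℕ-fromℕ<; all?)
open import Data.Fin.Subset using (Subset; _⊂_; ∣_∣) renaming (_∈_ to _∈ˢ_)
open import Data.Fin.Subset.Properties using (anySubset?; p⊂q⇒∣p∣<∣q∣)
open import Data.Vec using (lookup; tabulate)
open import Data.Vec.Properties using (lookup∘tabulate; lookup⇒[]=; []=⇒lookup)
open import Data.Bool using (true; false; _∧_; _∨_) renaming (_≟_ to _≟ᵇ_)
open import Data.Bool.Properties using (∧-conicalˡ; ∧-conicalʳ)
open import Data.List using (List; []; _∷_; cartesianProduct; allFin)
open import Data.List.Membership.Propositional using (_∈_)
open import Data.List.Membership.Propositional.Properties using (∈-cartesianProduct⁺; ∈-allFin)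
open import Data.List.Relation.Unary.Any using (here; there)
open import Data.Product using (_×_; ∃-syntax; _,_; proj₂)
open import Data.Product.Relation.Binary.Lex.Strict using (×-strictTotalOrder)
open import Data.Product.Relation.Binary.Pointwise.NonDependent using (Pointwise)
open import Data.Sum using (_⊎_; inj₁; inj₂; swap; [_,_]′)
open import Data.Empty using (⊥-elim)
open import Function using (_∘_)
open import Function.Bundles using (_⇔_; mk⇔)
open import Relation.Nullary using (¬_; Dec; yes; no; does; contradiction; ¬?)
open import Relation.Nullary.Decidable using (map′; _⊎-dec_; _×-dec_; dec-true)
open import Relation.Binary using (StrictPartialOrder; StrictTotalOrder; Tri; tri<; tri≈; tri>)
open import Relation.Binary.PropositionalEquality using (_≡_; _≢_; refl; sym; trans; cong; subst)
open import Relation.Binary.Construct.Closure.Transitive using (TransClosure; [_]; _∷_; _∷ʳ_)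
open import Defs

private
  variable
    n : ℕ

does-sound : ∀ {p} {P : Set p} (P? : Dec P) → does P? ≡ true → P
does-sound (yes p) _ = p

⊆D-refl : {D : Digraph n} → D ⊆D D
⊆D-refl u v e = e

⊆D-trans : {D₁ D₂ D₃ : Digraph n} → D₁ ⊆D D₂ → D₂ ⊆D D₃ → D₁ ⊆D D₃
⊆D-trans s t u v e = t u v (s u v e)

TransClosure-⊆D : {D D′ : Digraph n} → D ⊆D D′ → ∀ {u v} → TransClosure (Edge D) u v → TransClosure (Edge D′) u v
TransClosure-⊆D s [ e ] = [ s _ _ e ]
TransClosure-⊆D s (e ∷ p) = s _ _ e ∷ TransClosure-⊆D s p

Acyclic-⊆D : {D D′ : Digraph n} → D ⊆D D′ → Acyclic D′ → Acyclic D
Acyclic-⊆D s acyclic v cycle = acyclic v (TransClosure-⊆D s cycle)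

module _ {c ℓ₁ ℓ₂ : Level} (S : StrictPartialOrder c ℓ₁ ℓ₂) where
  open StrictPartialOrder S using (Carrier; irrefl; module Eq) renaming (_<_ to _≺_; trans to ≺-trans)

  acyclic-by-ranking : {G : Digraph n} (f : Fin n → Carrier) → (∀ {u v} → Edge G u v → f u ≺ f v) → Acyclic G
  acyclic-by-ranking {G = G} f increasing v cycle = irrefl Eq.refl (along cycle)
    where
    along : ∀ {u w} → TransClosure (Edge G) u w → f u ≺ f w
    along [ e ] = increasing e
    along (e ∷ p) = ≺-trans (increasing e) (along p)

invert-⊆D : (X : VSet n) {D D′ : Digraph n} → D ⊆D D′ → invert X D ⊆D invert X D′
invert-⊆D X s u v e with X u ∧ X v
... | true = s v u e
... | false = s u v e

invertAll-⊆D : (Xs : List (VSet n)) {D D′ : Digraph n} → D ⊆D D′ → invertAll Xs D ⊆D invertAll Xs D′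
invertAll-⊆D [] s = s
invertAll-⊆D (X ∷ Xs) s = invertAll-⊆D Xs (invert-⊆D X s)

invert-cong : {X Y : VSet n} (D : Digraph n) → (∀ x → X x ≡ Y x) → invert X D ⊆D invert Y D
invert-cong D X≗Y u v e rewrite X≗Y u | X≗Y v = e

invert-involutive : (X : VSet n) (D : Digraph n) → ∀ u v → invert X (invert X D) u v ≡ D u v
invert-involutive X D u v with X u | X v
... | true  | true  = refl
... | true  | false = refl
... | false | true  = refl
... | false | false = refl

invert-oriented : (X : VSet n) {D : Digraph n} → Oriented D → Oriented (invert X D)
invert-oriented X {D} (loopless , antisymmetric) = loopless′ , antisymmetric′
  where
  loopless′ : ∀ v → ¬ Edge (invert X D) v v
  loopless′ v with X v ∧ X v
  ... | true  = loopless v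
  ... | false = loopless v
  antisymmetric′ : ∀ u v → Edge (invert X D) u v → ¬ Edge (invert X D) v u
  antisymmetric′ u v with X u | X v
  ... | true  | true  = antisymmetric v u
  ... | true  | false = antisymmetric u v
  ... | false | true  = antisymmetric u v
  ... | false | false = antisymmetric u v

invert-tournament : (X : VSet n) {T : Digraph n} → Tournament T → Tournament (invert X T)
invert-tournament X {T} (oriented , semicomplete) = invert-oriented X oriented , semicomplete′
  where
  semicomplete′ : ∀ u v → u ≢ v → Edge (invert X T) u v ⊎ Edge (invert X T) v u
  semicomplete′ u v u≢v with X u | X v
  ... | true  | true  = swap (semicomplete u v u≢v)
  ... | true  | false = semicomplete u v u≢v
  ... | false | true  = semicomplete u v u≢v
  ... | false | false = semicomplete u v u≢v

uninvertAll : List (VSet n) → Digraph n → Digraph n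
uninvertAll [] D = D
uninvertAll (X ∷ Xs) D = invert X (uninvertAll Xs D)

uninvertAll-⊆D : (Xs : List (VSet n)) {D D′ : Digraph n} → D ⊆D D′ → uninvertAll Xs D ⊆D uninvertAll Xs D′
uninvertAll-⊆D [] s = s
uninvertAll-⊆D (X ∷ Xs) s = invert-⊆D X (uninvertAll-⊆D Xs s)

uninvertAll-tournament : (Xs : List (VSet n)) {T : Digraph n} → Tournament T → Tournament (uninvertAll Xs T)
uninvertAll-tournament [] t = t
uninvertAll-tournament (X ∷ Xs) t = invert-tournament X (uninvertAll-tournament Xs t)

invertAll-uninvertAll : (Xs : List (VSet n)) (D : Digraph n) → invertAll Xs (uninvertAll Xs D) ⊆D D
invertAll-uninvertAll [] D = ⊆D-refl
invertAll-uninvertAll (X ∷ Xs) D =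
  ⊆D-trans (invertAll-⊆D Xs (λ u v → subst (_≡ true) (invert-involutive X (uninvertAll Xs D) u v)))
           (invertAll-uninvertAll Xs D)

uninvertAll-invertAll : (Xs : List (VSet n)) (D : Digraph n) → D ⊆D uninvertAll Xs (invertAll Xs D)
uninvertAll-invertAll [] D = ⊆D-refl
uninvertAll-invertAll (X ∷ Xs) D =
  ⊆D-trans (λ u v → subst (_≡ true) (sym (invert-involutive X D u v)))
           (invert-⊆D X (uninvertAll-invertAll Xs (invert X D)))

invertibleWith-⊆D : {D D′ : Digraph n} {k : ℕ} → D ⊆D D′ → InvertibleWith D′ k → InvertibleWith D k
invertibleWith-⊆D s (Xs , length≡k , acyclic) = Xs , length≡k , Acyclic-⊆D (invertAll-⊆D Xs s) acyclic

Ascending : Digraph n → Fin n → Fin n → Set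
Ascending G u v = Edge G u v → toℕ u < toℕ v

ascending-acyclic : {G : Digraph n} → (∀ u v → Ascending G u v) → Acyclic G
ascending-acyclic ascending = acyclic-by-ranking <-strictPartialOrder toℕ (ascending _ _)

Backward : Digraph n → Fin n → Fin n → Set
Backward G u v = Edge G u v × toℕ v < toℕ u

backward? : (G : Digraph n) → ∀ u v → Dec (Backward G u v)
backward? G u v = (G u v ≟ᵇ true) ×-dec (toℕ v <? toℕ u)

pair : Fin n → Fin n → VSet n
pair a b x = does (x ≟ a) ∨ does (x ≟ b)

pair-⊆ : (a b x : Fin n) → pair a b x ≡ true → x ≡ a ⊎ x ≡ b
pair-⊆ a b x _ with x ≟ a | x ≟ b
... | yes x≡a | _       = inj₁ x≡a
... | no _    | yes x≡b = inj₂ x≡b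

pair-⊇ : (a b : Fin n) → pair a b a ∧ pair a b b ≡ true
pair-⊇ a b rewrite dec-true (a ≟ a) refl | dec-true (b ≟ b) refl with does (b ≟ a)
... | true  = refl
... | false = refl

invert-pair-ascending : {G : Digraph n} {a b : Fin n} → Oriented G → Backward G a b →
  ∀ x y → Ascending G x y ⊎ (x ≡ a × y ≡ b) → Ascending (invert (pair a b) G) x y
invert-pair-ascending {G = G} {a} {b} (loopless , antisymmetric) (ab , b<a) x y old
  with pair a b x ∧ pair a b y in inside
... | false = λ e → case old e
  where
  case : Ascending G x y ⊎ (x ≡ a × y ≡ b) → Ascending G x y
  case (inj₁ asc) = asc
  case (inj₂ (refl , refl)) = contradiction (trans (sym inside) (pair-⊇ a b)) λ ()
... | true with pair-⊆ a b x (∧-conicalˡ _ _ inside) | pair-⊆ a b y (∧-conicalʳ _ _ inside)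
...   | inj₁ refl | inj₁ refl = ⊥-elim ∘ loopless a
...   | inj₁ refl | inj₂ refl = ⊥-elim ∘ antisymmetric a b ab
...   | inj₂ refl | inj₁ refl = λ _ → b<a
...   | inj₂ refl | inj₂ refl = ⊥-elim ∘ loopless b

ascendingFamily : List (Fin n × Fin n) → Digraph n → List (VSet n)
ascendingFamily [] G = []
ascendingFamily ((a , b) ∷ ps) G with backward? G a b
... | yes _ = pair a b ∷ ascendingFamily ps (invert (pair a b) G)
... | no _  = ascendingFamily ps G

not-backward-ascending : {G : Digraph n} {a b : Fin n} → Oriented G → ¬ Backward G a b → Ascending G a b
not-backward-ascending {a = a} {b} (loopless , _) not-backward ab = ≤∧≢⇒< (≮⇒≥ (not-backward ∘ (ab ,_))) a≢b
  where
  a≢b : toℕ a ≢ toℕ b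
  a≢b a≡b with toℕ-injective a≡b
  ... | refl = loopless a ab

ascendingFamily-ascending : (ps : List (Fin n × Fin n)) (G : Digraph n) → Oriented G →
  ∀ x y → Ascending G x y ⊎ (x , y) ∈ ps → Ascending (invertAll (ascendingFamily ps G) G) x y
ascendingFamily-ascending [] G _ x y (inj₁ asc) = asc
ascendingFamily-ascending ((a , b) ∷ ps) G oriented x y old with backward? G a b
... | yes backward = ascendingFamily-ascending ps _ (invert-oriented (pair a b) oriented) x y (step old)
  where
  step : Ascending G x y ⊎ (x , y) ∈ (a , b) ∷ ps → Ascending (invert (pair a b) G) x y ⊎ (x , y) ∈ ps
  step (inj₁ asc)        = inj₁ (invert-pair-ascending oriented backward x y (inj₁ asc))
  step (inj₂ (here refl)) = inj₁ (invert-pair-ascending oriented backward x y (inj₂ (refl , refl)))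
  step (inj₂ (there m))  = inj₂ m
... | no not-backward = ascendingFamily-ascending ps G oriented x y (step old)
  where
  step : Ascending G x y ⊎ (x , y) ∈ (a , b) ∷ ps → Ascending G x y ⊎ (x , y) ∈ ps
  step (inj₁ asc)        = inj₁ asc
  step (inj₂ (here refl)) = inj₁ (not-backward-ascending oriented not-backward)
  step (inj₂ (there m))  = inj₂ m

invertibleWith-some : {D : Digraph n} → Oriented D → ∃[ m ] InvertibleWith D m
invertibleWith-some {n} {D} oriented = _ , ascendingFamily pairs D , refl , ascending-acyclic λ x y →
  ascendingFamily-ascending pairs D oriented x y (inj₂ (∈-cartesianProduct⁺ (∈-allFin x) (∈-allFin y)))
  where
  pairs : List (Fin n × Fin n)
  pairs = cartesianProduct (allFin n) (allFin n)

module Reachability (G : Digraph n) where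

  -- Floyd–Warshall: walks whose interior vertices all have index below k.
  data WalkBelow (k : ℕ) : Fin n → Fin n → Set where
    [_] : ∀ {u v} → Edge G u v → WalkBelow k u v
    _∷⟨_⟩_ : ∀ {u w v} → Edge G u w → toℕ w < k → WalkBelow k w v → WalkBelow k u v

  toTransClosure : ∀ {k u v} → WalkBelow k u v → TransClosure (Edge G) u v
  toTransClosure [ e ] = [ e ]
  toTransClosure (e ∷⟨ _ ⟩ p) = e ∷ toTransClosure p

  fromTransClosure : ∀ {u v} → TransClosure (Edge G) u v → WalkBelow n u v
  fromTransClosure [ e ] = [ e ]
  fromTransClosure (e ∷ p) = e ∷⟨ toℕ<n _ ⟩ fromTransClosure p

  weaken : ∀ {k u v} → WalkBelow k u v → WalkBelow (suc k) u v
  weaken [ e ] = [ e ]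
  weaken (e ∷⟨ w<k ⟩ p) = e ∷⟨ m<n⇒m<1+n w<k ⟩ weaken p

  strengthen : ∀ {k u v} → n ≤ k → WalkBelow (suc k) u v → WalkBelow k u v
  strengthen _ [ e ] = [ e ]
  strengthen n≤k (e ∷⟨ _ ⟩ p) = e ∷⟨ <-≤-trans (toℕ<n _) n≤k ⟩ strengthen n≤k p

  join : ∀ {k u c v} → toℕ c < k → WalkBelow k u c → WalkBelow k c v → WalkBelow k u v
  join c<k [ e ] q = e ∷⟨ c<k ⟩ q
  join c<k (e ∷⟨ w<k ⟩ p) q = e ∷⟨ w<k ⟩ join c<k p q

  -- Cut a walk at its first visit to c; the tail is shortcut at the last visit.
  split : ∀ {k u v} (c : Fin n) → toℕ c ≡ k →
    WalkBelow (suc k) u v → WalkBelow k u v ⊎ (WalkBelow k u c × WalkBelow k c v)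
  split c c≡k [ e ] = inj₁ [ e ]
  split {k} {v = v} c c≡k (_∷⟨_⟩_ {w = w} e w<1+k p) with toℕ w ≟ℕ k | split c c≡k p
  ... | no w≢k | inj₁ q = inj₁ (e ∷⟨ ≤∧≢⇒< (≤-pred w<1+k) w≢k ⟩ q)
  ... | no w≢k | inj₂ (q , r) = inj₂ (e ∷⟨ ≤∧≢⇒< (≤-pred w<1+k) w≢k ⟩ q , r)
  ... | yes w≡k | rest with toℕ-injective (trans w≡k (sym c≡k))
  ...   | refl = inj₂ ([ e ] , tail rest)
    where
    tail : WalkBelow k c v ⊎ (WalkBelow k c c × WalkBelow k c v) → WalkBelow k c v
    tail (inj₁ q) = q
    tail (inj₂ (_ , q)) = q

  walkBelow? : ∀ k u v → Dec (WalkBelow k u v)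
  walkBelow? zero u v = map′ [_] edge (G u v ≟ᵇ true)
    where
    edge : WalkBelow 0 u v → Edge G u v
    edge [ e ] = e
  walkBelow? (suc k) u v with k <? n
  ... | yes k<n = map′ merge (split c (toℕ-fromℕ< k<n))
                   (walkBelow? k u v ⊎-dec (walkBelow? k u c ×-dec walkBelow? k c v))
    where
    c : Fin n
    c = fromℕ< k<n
    merge : WalkBelow k u v ⊎ (WalkBelow k u c × WalkBelow k c v) → WalkBelow (suc k) u v
    merge (inj₁ p) = weaken p
    merge (inj₂ (p , q)) = join (s≤s (≤-reflexive (toℕ-fromℕ< k<n))) (weaken p) (weaken q)
  ... | no k≮n = map′ weaken (strengthen (≮⇒≥ k≮n)) (walkBelow? k u v)

  reachable? : ∀ u v → Dec (TransClosure (Edge G) u v)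
  reachable? u v = map′ toTransClosure fromTransClosure (walkBelow? n u v)

  acyclic? : Dec (Acyclic G)
  acyclic? = all? (λ v → ¬? (reachable? v v))

module _ {c ℓ₁ ℓ₂ : Level} (S : StrictTotalOrder c ℓ₁ ℓ₂) where
  open StrictTotalOrder S
    using (Carrier; _≈_; compare; irrefl; asym; strictPartialOrder; module Eq)
    renaming (_<_ to _≺_; _<?_ to _≺?_)

  orderTournament : (f : Fin n → Carrier) → Digraph n
  orderTournament f u v = does (f u ≺? f v)

  orderTournament-sound : (f : Fin n → Carrier) → ∀ {u v} → Edge (orderTournament f) u v → f u ≺ f v
  orderTournament-sound f {u} {v} = does-sound (f u ≺? f v)

  orderTournament-complete : (f : Fin n → Carrier) → ∀ {u v} → f u ≺ f v → Edge (orderTournament f) u v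
  orderTournament-complete f {u} {v} = dec-true (f u ≺? f v)

  orderTournament-tournament : (f : Fin n → Carrier) → (∀ {u v} → f u ≈ f v → u ≡ v) →
    Tournament (orderTournament f)
  orderTournament-tournament f injective = (loopless , antisymmetric) , semicomplete
    where
    loopless : ∀ v → ¬ Edge (orderTournament f) v v
    loopless v = irrefl Eq.refl ∘ orderTournament-sound f
    antisymmetric : ∀ u v → Edge (orderTournament f) u v → ¬ Edge (orderTournament f) v u
    antisymmetric u v uv vu = asym (orderTournament-sound f uv) (orderTournament-sound f vu)
    semicomplete : ∀ u v → u ≢ v → Edge (orderTournament f) u v ⊎ Edge (orderTournament f) v u
    semicomplete u v u≢v = fromTri (compare (f u) (f v))
      where
      fromTri : Tri (f u ≺ f v) (f u ≈ f v) (f v ≺ f u) →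
        Edge (orderTournament f) u v ⊎ Edge (orderTournament f) v u
      fromTri (tri< u≺v _ _) = inj₁ (orderTournament-complete f u≺v)
      fromTri (tri≈ _ u≈v _) = contradiction (injective u≈v) u≢v
      fromTri (tri> _ _ v≺u) = inj₂ (orderTournament-complete f v≺u)

  orderTournament-acyclic : (f : Fin n → Carrier) → Acyclic (orderTournament f)
  orderTournament-acyclic f = acyclic-by-ranking strictPartialOrder f (orderTournament-sound f)

module _ {A : Digraph n} (acyclic : Acyclic A) where
  open Reachability A using (reachable?)

  ancestors : Fin n → Subset n
  ancestors v = tabulate (λ w → does (reachable? w v))

  ancestors-complete : ∀ {w v} → TransClosure (Edge A) w v → w ∈ˢ ancestors v
  ancestors-complete {w} {v} p = lookup⇒[]= w _ (trans (lookup∘tabulate _ w) (dec-true (reachable? w v) p))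

  ancestors-sound : ∀ {w v} → w ∈ˢ ancestors v → TransClosure (Edge A) w v
  ancestors-sound {w} {v} w∈ = does-sound (reachable? w v) (trans (sym (lookup∘tabulate _ w)) ([]=⇒lookup w∈))

  ancestors-⊂ : ∀ {u v} → Edge A u v → ancestors u ⊂ ancestors v
  ancestors-⊂ {u} uv = (λ w∈ → ancestors-complete (ancestors-sound w∈ ∷ʳ uv)) ,
                       u , ancestors-complete [ uv ] , acyclic u ∘ ancestors-sound

  -- Ancestor counts order A topologically; indices break the ties.
  rank : Fin n → ℕ × ℕ
  rank v = ∣ ancestors v ∣ , toℕ v

  rank-injective : ∀ {u v} → Pointwise _≡_ _≡_ (rank u) (rank v) → u ≡ v
  rank-injective (_ , u≡v) = toℕ-injective u≡v

transitive-tournament-extension : {A : Digraph n} → Acyclic A → ∃[ T ] (Tournament T × Acyclic T × A ⊆D T)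
transitive-tournament-extension {A = A} acyclic =
  orderTournament lex (rank acyclic) ,
  orderTournament-tournament lex (rank acyclic) (rank-injective acyclic) ,
  orderTournament-acyclic lex (rank acyclic) ,
  λ u v uv → orderTournament-complete lex (rank acyclic)
               (inj₁ (p⊂q⇒∣p∣<∣q∣ (ancestors-⊂ acyclic uv)))
  where
  lex = ×-strictTotalOrder <-strictTotalOrder <-strictTotalOrder

invertibleWith? : (k : ℕ) (D : Digraph n) → Dec (InvertibleWith D k)
invertibleWith? zero D =
  map′ (λ acyclic → [] , refl , acyclic) (λ { ([] , _ , acyclic) → acyclic }) (Reachability.acyclic? D)
invertibleWith? {n} (suc k) D =
  map′ cons uncons (anySubset? λ (X : Subset n) → invertibleWith? k (invert (lookup X) D))
  where
  cons : ∃[ X ] InvertibleWith (invert (lookup X) D) k → InvertibleWith D (suc k)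
  cons (X , Xs , length≡k , acyclic) = lookup X ∷ Xs , cong suc length≡k , acyclic
  uncons : InvertibleWith D (suc k) → ∃[ X ] InvertibleWith (invert (lookup X) D) k
  uncons (X ∷ Xs , length≡1+k , acyclic) =
    tabulate X , invertibleWith-⊆D (invert-cong D (lookup∘tabulate X)) (Xs , suc-injective length≡1+k , acyclic)

module _ {P : ℕ → Set} (P? : ∀ k → Dec (P k)) where

  Least : ℕ → Set
  Least k = P k × ∀ j → j < k → ¬ P j

  least-or-none-below : ∀ m → ∃[ k ] Least k ⊎ (∀ j → j < m → ¬ P j)
  least-or-none-below zero = inj₂ λ _ ()
  least-or-none-below (suc m) with least-or-none-below m
  ... | inj₁ found = inj₁ found
  ... | inj₂ none with P? m
  ...   | yes pm = inj₁ (m , pm , none)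
  ...   | no ¬pm = inj₂ λ j j<1+m → [ none j , (λ { refl → ¬pm }) ]′ (m<1+n⇒m<n∨m≡n j<1+m)

  least-witness : ∀ {m} → P m → ∃[ k ] Least k
  least-witness {m} pm with least-or-none-below (suc m)
  ... | inj₁ found = found
  ... | inj₂ none = contradiction pm (none m ≤-refl)

isInv-exists : {D : Digraph n} → Oriented D → ∃[ k ] IsInv D k
isInv-exists {D = D} oriented =
  least-witness (λ k → invertibleWith? k D) (proj₂ (invertibleWith-some oriented))

isInv-unique : {D : Digraph n} {k k′ : ℕ} → IsInv D k → IsInv D k′ → k ≡ k′
isInv-unique {k = k} {k′} (invertible , minimal) (invertible′ , minimal′) with <-cmp k k′
... | tri< k<k′ _ _ = contradiction invertible (minimal′ k k<k′)
... | tri≈ _ k≡k′ _ = k≡k′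
... | tri> _ _ k′<k = contradiction invertible′ (minimal k′ k′<k)

isInv-⇔ : {D D′ : Digraph n} {k : ℕ} → IsInv D k → IsInv D′ k → ∀ j → IsInv D j ⇔ IsInv D′ j
isInv-⇔ {D = D} {D′} isInv isInv′ j = mk⇔
  (λ isInvⱼ → subst (IsInv D′) (isInv-unique isInv isInvⱼ) isInv′)
  (λ isInvⱼ → subst (IsInv D) (isInv-unique isInv′ isInvⱼ) isInv)

isInv-⊆D : {D D′ : Digraph n} {k : ℕ} → D ⊆D D′ → IsInv D k → InvertibleWith D′ k → IsInv D′ k
isInv-⊆D D⊆D′ (_ , minimal) invertible′ = invertible′ , λ j j<k → minimal j j<k ∘ invertibleWith-⊆D D⊆D′

proposition2p3 : (n : ℕ) (D : Digraph n) → Oriented D →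
    ∃[ D* ] (Tournament D* × D ⊆D D* × (∀ k → IsInv D* k ⇔ IsInv D k))
proposition2p3 n D oriented with isInv-exists oriented
... | k , isInv@((Xs , length≡k , acyclic) , _) with transitive-tournament-extension acyclic
... | T , tournament , T-acyclic , A⊆T = D* , uninvertAll-tournament Xs tournament , D⊆D* , isInv-⇔ isInv* isInv
  where
  D* : Digraph n
  D* = uninvertAll Xs T
  D⊆D* : D ⊆D D*
  D⊆D* = ⊆D-trans (uninvertAll-invertAll Xs D) (uninvertAll-⊆D Xs A⊆T)
  isInv* : IsInv D* k
  isInv* = isInv-⊆D D⊆D* isInv (Xs , length≡k , Acyclic-⊆D (invertAll-uninvertAll Xs T) T-acyclic)
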